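{- Let $2\le a\le b\le c$ be integers such that $m:=F(a)^2+F(b)^2+F(c)^2-3F(a)F(b)F(c)>0$, so that $(F(a),F(b),F(c))$ is a Markoff $m$-triple. Then this triple is minimal, i.e. $F(c)\ge 3F(a)F(b)$, if and only if either $c\ge a+b+1$, or $a=b=2$ and $c=4$.
   Context: $F(n)$ denotes the $n$-th Fibonacci number, $F(0)=0$, $F(1)=1$, $F(n+1)=F(n)+F(n-1)$. A Markoff $m$-triple is a triple $(x,y,z)$ of positive integers with $x\le y\le z$ satisfying $x^2+y^2+z^2=3xyz+m$; it is minimal if $z\ge 3xy$. -}

module Defs where

open import Data.Nat using (ℕ; zero; suc; _+_)

F : ℕ → ℕ
F zero = 0
F (suc zero) = 1
F (suc (suc n)) = F (suc n) + F n

-- By the addition formula F(m+n+1) = F(m+1)F(n+1) + F(m)F(n):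
--   F(a+b+1) = F(a+1)F(b+1) + F(a)F(b) ≥ (9/4 + 1)F(a)F(b), as F(n+1) ≥ 3F(n)/2 for n ≥ 2,
--   F(a+b)   = F(a)(F(b) + F(b-1)) + F(a-1)F(b) ≤ 3F(a)F(b),
-- with equality in the second only if F(b-1) = F(b) and F(a-1) = F(a), i.e. a = b = 2.
-- Since F is monotone, F(c) ≥ 3F(a)F(b) thus holds when c > a + b, and when c ≤ a + b
-- only for a = b = 2 and F(c) = 3.
module Submission where

open import Defs
open import Data.Nat using (ℕ; zero; suc; _+_; _*_; _≤_; _<_; _>_; _≥_; _≤?_; _≤′_; z≤n; s≤s; z<s; ≤′-refl; ≤′-step; >-nonZero)
open import Data.Nat.Properties
open import Data.Nat.Tactic.RingSolver using (solve-∀)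
open import Data.Sum using (_⊎_; inj₁; inj₂)
open import Data.Product using (_×_; _,_)
open import Relation.Binary.PropositionalEquality using (_≡_; refl; sym; trans; cong; subst; module ≡-Reasoning)
open import Relation.Nullary using (yes; no; contradiction)
open import Function.Bundles using (_⇔_; mk⇔)

F-addition : ∀ m n → F (suc (m + n)) ≡ F (suc m) * F (suc n) + F m * F n
F-addition zero n = sym (trans (+-identityʳ _) (*-identityˡ _))
F-addition (suc m) n = begin
  F (suc (suc m + n))                              ≡⟨ cong (λ k → F (suc k)) (+-suc m n) ⟨
  F (suc (m + suc n))                              ≡⟨ F-addition m (suc n) ⟩
  F (suc m) * (F (suc n) + F n) + F m * F (suc n)  ≡⟨ regroup (F (suc m)) (F m) (F (suc n)) (F n) ⟩
  (F (suc m) + F m) * F (suc n) + F (suc m) * F n  ∎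
  where
  open ≡-Reasoning
  regroup : ∀ x y z w → x * (z + w) + y * z ≡ (x + y) * z + x * w
  regroup = solve-∀

F[1+n]>0 : ∀ n → F (suc n) > 0
F[1+n]>0 zero    = z<s
F[1+n]>0 (suc n) = ≤-trans (F[1+n]>0 n) (m≤m+n _ _)

F[n]≤F[1+n] : ∀ n → F n ≤ F (suc n)
F[n]≤F[1+n] zero          = z≤n
F[n]≤F[1+n] (suc zero)    = ≤-refl
F[n]≤F[1+n] (suc (suc n)) = m≤m+n _ _

F[2+n]<F[3+n] : ∀ n → F (2 + n) < F (3 + n)
F[2+n]<F[3+n] n = m<m+n (F (2 + n)) (F[1+n]>0 n)

F-mono-≤ : ∀ {m n} → m ≤ n → F m ≤ F n
F-mono-≤ m≤n = go (≤⇒≤′ m≤n)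
  where
  go : ∀ {m n} → m ≤′ n → F m ≤ F n
  go ≤′-refl            = ≤-refl
  go (≤′-step {n} m≤′n) = ≤-trans (go m≤′n) (F[n]≤F[1+n] n)

F[n]≡F[1+n]⇒n≡1 : ∀ n → F n ≡ F (suc n) → n ≡ 1
F[n]≡F[1+n]⇒n≡1 (suc zero)    _  = refl
F[n]≡F[1+n]⇒n≡1 (suc (suc n)) eq = contradiction eq (<⇒≢ (F[2+n]<F[3+n] n))

3≤F[n]⇒4≤n : ∀ n → 3 ≤ F n → 4 ≤ n
3≤F[n]⇒4≤n (suc (suc (suc (suc n)))) _ = s≤s (s≤s (s≤s (s≤s z≤n)))
3≤F[n]⇒4≤n (suc zero)             (s≤s ())
3≤F[n]⇒4≤n (suc (suc zero))       (s≤s ())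
3≤F[n]⇒4≤n (suc (suc (suc zero))) (s≤s (s≤s ()))

3*F[n]≤2*F[1+n] : ∀ {n} → 2 ≤ n → 3 * F n ≤ 2 * F (suc n)
3*F[n]≤2*F[1+n] {suc (suc n)} (s≤s (s≤s _)) = begin
  3 * (F (suc n) + F n)                          ≡⟨ split (F (suc n)) (F n) ⟩
  2 * (F (suc n) + F n) + F (suc n) + F n        ≤⟨ +-monoʳ-≤ _ (F[n]≤F[1+n] n) ⟩
  2 * (F (suc n) + F n) + F (suc n) + F (suc n)  ≡⟨ merge (F (suc n)) (F n) ⟩
  2 * ((F (suc n) + F n) + F (suc n))            ∎
  where
  open ≤-Reasoning
  split : ∀ x y → 3 * (x + y) ≡ 2 * (x + y) + x + y
  split = solve-∀
  merge : ∀ x y → 2 * (x + y) + x + x ≡ 2 * ((x + y) + x)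
  merge = solve-∀

3*m≤2*o⇒3*n≤2*p⇒2*[m*n]≤o*p : ∀ {m n o p} → 3 * m ≤ 2 * o → 3 * n ≤ 2 * p → 2 * (m * n) ≤ o * p
3*m≤2*o⇒3*n≤2*p⇒2*[m*n]≤o*p {m} {n} {o} {p} 3m≤2o 3n≤2p = *-cancelˡ-≤ 4 (begin
  4 * (2 * (m * n))          ≤⟨ m≤n+m _ (m * n) ⟩
  m * n + 4 * (2 * (m * n))  ≡⟨ nine m n ⟩
  (3 * m) * (3 * n)          ≤⟨ *-mono-≤ 3m≤2o 3n≤2p ⟩
  (2 * o) * (2 * p)          ≡⟨ four o p ⟩
  4 * (o * p)                ∎)
  where
  open ≤-Reasoning
  nine : ∀ x y → x * y + 4 * (2 * (x * y)) ≡ (3 * x) * (3 * y)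
  nine = solve-∀
  four : ∀ x y → (2 * x) * (2 * y) ≡ 4 * (x * y)
  four = solve-∀

3*F[a]*F[b]≤F[1+a+b] : ∀ {a b} → 2 ≤ a → 2 ≤ b → 3 * F a * F b ≤ F (suc (a + b))
3*F[a]*F[b]≤F[1+a+b] {a} {b} 2≤a 2≤b = begin
  3 * F a * F b                      ≡⟨ split (F a) (F b) ⟩
  2 * (F a * F b) + F a * F b        ≤⟨ +-monoˡ-≤ (F a * F b) 2FaFb≤F[1+a]F[1+b] ⟩
  F (suc a) * F (suc b) + F a * F b  ≡⟨ F-addition a b ⟨
  F (suc (a + b))                    ∎
  where
  open ≤-Reasoning
  split : ∀ x y → 3 * x * y ≡ 2 * (x * y) + x * y
  split = solve-∀
  2FaFb≤F[1+a]F[1+b] : 2 * (F a * F b) ≤ F (suc a) * F (suc b)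
  2FaFb≤F[1+a]F[1+b] = 3*m≤2*o⇒3*n≤2*p⇒2*[m*n]≤o*p {F a} {F b} {F (suc a)} {F (suc b)}
    (3*F[n]≤2*F[1+n] 2≤a) (3*F[n]≤2*F[1+n] 2≤b)

3*m*n≤m*[n+o]+p*n⇒o≡n×p≡m : ∀ {m n o p} → m > 0 → n > 0 → o ≤ n → p ≤ m →
                              3 * m * n ≤ m * (n + o) + p * n → o ≡ n × p ≡ m
3*m*n≤m*[n+o]+p*n⇒o≡n×p≡m {m} {n} {o} {p} m>0 n>0 o≤n p≤m 3mn≤ =
  cases (m≤n⇒m<n∨m≡n o≤n) (m≤n⇒m<n∨m≡n p≤m)
  where
  below-3mn : ∀ {k} → k < m * (n + n) + m * n → k < 3 * m * n
  below-3mn {k} = subst (k <_) (three m n)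
    where
    three : ∀ x y → x * (y + y) + x * y ≡ 3 * x * y
    three = solve-∀
  cases : o < n ⊎ o ≡ n → p < m ⊎ p ≡ m → o ≡ n × p ≡ m
  cases (inj₂ o≡n) (inj₂ p≡m) = o≡n , p≡m
  cases (inj₁ o<n) _          = contradiction 3mn≤ (<⇒≱ (below-3mn
    (+-mono-<-≤ (*-monoʳ-< m {{>-nonZero m>0}} (+-monoʳ-< n o<n)) (*-monoˡ-≤ n p≤m))))
  cases (inj₂ _)   (inj₁ p<m) = contradiction 3mn≤ (<⇒≱ (below-3mn
    (+-mono-≤-< (*-monoʳ-≤ m (+-monoʳ-≤ n o≤n)) (*-monoˡ-< n {{>-nonZero n>0}} p<m))))

3*F[a]*F[b]≤F[a+b]⇒a≡2×b≡2 : ∀ {a b} → a > 0 → b > 0 → 3 * F a * F b ≤ F (a + b) → a ≡ 2 × b ≡ 2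
3*F[a]*F[b]≤F[a+b]⇒a≡2×b≡2 {suc i} {suc j} _ _ 3FaFb≤F[a+b]
  with 3*m*n≤m*[n+o]+p*n⇒o≡n×p≡m (F[1+n]>0 i) (F[1+n]>0 j) (F[n]≤F[1+n] j) (F[n]≤F[1+n] i)
         (subst (3 * F (suc i) * F (suc j) ≤_) (F-addition i (suc j)) 3FaFb≤F[a+b])
... | Fj≡F[1+j] , Fi≡F[1+i] = cong suc (F[n]≡F[1+n]⇒n≡1 i Fi≡F[1+i]) , cong suc (F[n]≡F[1+n]⇒n≡1 j Fj≡F[1+j])

c≤a+b∧3*F[a]*F[b]≤F[c]⇒a≡2×b≡2×c≡4 : ∀ {a b c} → a > 0 → b > 0 → c ≤ a + b → 3 * F a * F b ≤ F c →
                                     a ≡ 2 × b ≡ 2 × c ≡ 4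
c≤a+b∧3*F[a]*F[b]≤F[c]⇒a≡2×b≡2×c≡4 a>0 b>0 c≤a+b 3FaFb≤Fc
  with 3*F[a]*F[b]≤F[a+b]⇒a≡2×b≡2 a>0 b>0 (≤-trans 3FaFb≤Fc (F-mono-≤ c≤a+b))
... | refl , refl = refl , refl , ≤-antisym c≤a+b (3≤F[n]⇒4≤n _ 3FaFb≤Fc)

proposition4p1 : (a b c : ℕ) → 2 ≤ a → a ≤ b → b ≤ c →
    3 * F a * F b * F c < F a * F a + F b * F b + F c * F c →
    (F c ≥ 3 * F a * F b ⇔ (c ≥ a + b + 1 ⊎ (a ≡ 2 × b ≡ 2 × c ≡ 4)))
proposition4p1 a b c 2≤a a≤b _ _ = mk⇔ minimal⇒ ⇒minimal
  where
  2≤b : 2 ≤ b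
  2≤b = ≤-trans 2≤a a≤b
  a+b+1≡1+a+b : a + b + 1 ≡ suc (a + b)
  a+b+1≡1+a+b = +-comm (a + b) 1
  ⇒minimal : c ≥ a + b + 1 ⊎ (a ≡ 2 × b ≡ 2 × c ≡ 4) → F c ≥ 3 * F a * F b
  ⇒minimal (inj₁ a+b+1≤c) =
    ≤-trans (3*F[a]*F[b]≤F[1+a+b] 2≤a 2≤b) (F-mono-≤ (subst (_≤ c) a+b+1≡1+a+b a+b+1≤c))
  ⇒minimal (inj₂ (refl , refl , refl)) = ≤-refl
  minimal⇒ : F c ≥ 3 * F a * F b → c ≥ a + b + 1 ⊎ (a ≡ 2 × b ≡ 2 × c ≡ 4)
  minimal⇒ minimal with a + b + 1 ≤? c
  ... | yes a+b+1≤c = inj₁ a+b+1≤c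
  ... | no  a+b+1≰c = inj₂ (c≤a+b∧3*F[a]*F[b]≤F[c]⇒a≡2×b≡2×c≡4 (<-≤-trans z<s 2≤a) (<-≤-trans z<s 2≤b)
                             (m<1+n⇒m≤n (subst (c <_) a+b+1≡1+a+b (≰⇒> a+b+1≰c))) minimal)
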